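{- For any positive integer $m$ and any integer $k$ with $3\le k\le \frac{m}{2}$, $$P_k(m)\le 2^{m H_2(1/k)},$$ where $H_2(x)=-x\log_2 x-(1-x)\log_2(1-x)$.
   Context: Write $[m]=\{1,\ldots,m\}$. For positive integers $N,m$ and a multiset $\mathcal{F}=\{C_1,\ldots,C_t\}$ of non-empty subsets of $[m]$ (repetitions allowed; members indexed by $[t]$), a resolution into $N$ classes is a partition $\{A_1,\ldots,A_N\}$ of $[t]$ into $N$ blocks such that for each $i$ the sets $C_j$, $j\in A_i$, are pairwise disjoint with union $[m]$. $\mathcal{F}$ is uniquely resolvable with respect to $(N,m)$ if it has exactly one resolution into $N$ classes (partitions regarded as unordered). For $2\le k\le m$, $P_k(m)$ is the largest integer $N$ such that there exists a uniquely resolvable multiset with respect to $(N,m)$ whose resolution consists of $N$ blocks each of size exactly $k$. -}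

module Defs where

open import Data.Nat using (ℕ; _≤_; _*_; _^_; _∸_)
open import Data.Fin using (Fin; _≟_)
open import Data.Fin.Subset using (Subset; _∈_; Nonempty; ∣_∣)
open import Data.Vec using (tabulate)
open import Data.Product using (Σ; ∃; _×_)
open import Function.Definitions using (Surjective)
open import Relation.Nullary using (¬_)
open import Relation.Nullary.Decidable using (⌊_⌋)
open import Relation.Binary.PropositionalEquality using (_≡_)
open import Function.Bundles using (_⇔_)

-- A multiset F = {C_1,...,C_t} of subsets of [m], indexed by Fin t.
Family : ℕ → ℕ → Set
Family t m = Fin t → Subset m

AllNonempty : ∀ {t m} → Family t m → Set
AllNonempty C = ∀ j → Nonempty (C j)

-- A partition of [t] into N blocks, given by a block-assignment map
-- f : Fin t → Fin N; surjectivity = every block is non-empty.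
IsResolution : ∀ {t m} (N : ℕ) → Family t m → (Fin t → Fin N) → Set
IsResolution {t} {m} N C f =
  Surjective _≡_ _≡_ f
  × (∀ (j j' : Fin t) (x : Fin m) → f j ≡ f j' → x ∈ C j → x ∈ C j' → j ≡ j')
  × (∀ (i : Fin N) (x : Fin m) → Σ (Fin t) λ j → f j ≡ i × x ∈ C j)

SamePartition : ∀ {t N} → (Fin t → Fin N) → (Fin t → Fin N) → Set
SamePartition {t} f g = ∀ (j j' : Fin t) → (f j ≡ f j') ⇔ (g j ≡ g j')

blockSize : ∀ {t N} → (Fin t → Fin N) → Fin N → ℕ
blockSize f i = ∣ tabulate (λ j → ⌊ f j ≟ i ⌋) ∣

-- There is a uniquely resolvable multiset w.r.t. (N,m) whose (unique)
-- resolution has all N blocks of size exactly k.  P_k(m) is the largest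
-- such N.
Achievable : ℕ → ℕ → ℕ → Set
Achievable k N m =
  Σ ℕ λ t → Σ (Family t m) λ C → Σ (Fin t → Fin N) λ f →
    AllNonempty C
    × IsResolution N C f
    × (∀ g → IsResolution N C g → SamePartition f g)
    × (∀ i → blockSize f i ≡ k)

{-# OPTIONS --safe #-}
-- In each block of the unique resolution the k members are pairwise disjoint, so one of
-- them, S_i, has k |S_i| ≤ m.  These representatives are pairwise distinct: if S_i = S_i'
-- with i ≠ i', exchanging the two equal members between their blocks yields a second,
-- different resolution (blocks have at least two members).  Give a subset S ⊆ [m] the
-- weight (k-1)^(m - |S|); all subsets together weigh k^m, hence
-- N (k-1)^(m - ⌊m/k⌋) ≤ k^m, and raising this to the k-th power, with k ⌊m/k⌋ ≤ m,
-- gives N^k (k-1)^(m(k-1)) ≤ k^(mk).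
module Submission where

open import Defs
open import Data.Nat using (ℕ; _≤_; _*_; _^_; _∸_; zero; suc; _+_; NonZero; z≤n; s≤s; >-nonZero⁻¹)
open import Data.Nat.Properties
  using ( +-suc; +-assoc; *-comm; *-zeroʳ; *-suc; *-distribˡ-+; *-distribʳ-∸; ^-*-assoc
        ; ≤-refl; n≮n; ≰⇒>; _≤?_; +-mono-≤; *-monoʳ-≤; *-cancelˡ-≤; ∸-monoʳ-≤; m+n∸m≡n
        ; ^-monoˡ-≤; ^-monoʳ-≤; +-commutativeSemigroup; *-commutativeSemigroup; module ≤-Reasoning)
open import Data.Nat.DivMod using (_/_; m/n*n≤m; m*n/n≡m; /-monoˡ-≤)
open import Data.Nat.ListAction using (sum)
open import Algebra.Properties.CommutativeSemigroup +-commutativeSemigroup using (x∙yz≈y∙xz)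
open import Algebra.Properties.CommutativeSemigroup *-commutativeSemigroup
  using () renaming (interchange to *-interchange)
open import Data.Bool.Base using (Bool)
import Data.Bool.Properties as Bool
open import Data.Empty using (⊥; ⊥-elim)
open import Data.Fin.Base using (Fin; zero; suc)
open import Data.Fin.Properties using (_≟_)
open import Data.Fin.Subset using (Subset; inside; outside; _∈_; _∪_; ⋃; ∁; ∣_∣)
open import Data.Fin.Subset.Properties using (∣p∣≤n; ∣∁p∣≡n∸∣p∣; ∣⊥∣≡0; x∈p∪q⁻; ∉⊥)
open import Data.Fin.Permutation using (Permutation′; _⟨$⟩ʳ_; _⟨$⟩ˡ_; inverseˡ; inverseʳ)
import Data.Fin.Permutation as Permutation
import Data.Fin.Permutation.Components as PC
open import Data.Vec.Base using (_∷_; []; here; there; tabulate)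
open import Data.List.Base using (List; []; _∷_; length; map; filter; allFin)
import Data.List.Base as List
open import Data.List.Properties using (length-tabulate; map-∘)
open import Data.List.Relation.Unary.All using (All; []; _∷_)
import Data.List.Relation.Unary.All as All
open import Data.List.Relation.Unary.All.Properties using (¬Any⇒All¬; all-filter)
import Data.List.Relation.Unary.All.Properties as All
open import Data.List.Relation.Unary.Any using (Any; here; there; any?)
open import Data.List.Relation.Unary.AllPairs using (AllPairs; []; _∷_)
import Data.List.Relation.Unary.AllPairs.Properties as AllPairs
open import Data.List.Relation.Unary.Unique.Propositional using (Unique)
open import Data.List.Relation.Unary.Unique.Propositional.Properties
  using (allFin⁺; filter⁺; tabulate⁺)
open import Data.List.Membership.Propositional using (find) renaming (_∈_ to _∈ˡ_)
open import Data.List.Membership.Propositional.Properties using (∈-filter⁻)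
open import Data.Product using (∃; _×_; _,_; proj₁; proj₂)
open import Data.Sum using (inj₁; inj₂)
open import Function.Base using (_∘_)
open import Function.Bundles using (Equivalence)
open import Relation.Nullary using (yes; no; contradiction)
open import Relation.Nullary.Decidable using (⌊_⌋)
open import Relation.Unary using (Decidable)
open import Relation.Binary.Definitions using (DecidableEquality)
open import Relation.Binary.PropositionalEquality
  using (_≡_; _≢_; refl; sym; trans; cong; subst; module ≡-Reasoning)

Disjoint : ∀ {n} → Subset n → Subset n → Set
Disjoint p q = ∀ {x} → x ∈ p → x ∈ q → ⊥

Disjoint-∷⁻ : ∀ {n a b} {p q : Subset n} → Disjoint (a ∷ p) (b ∷ q) → Disjoint p q
Disjoint-∷⁻ d x∈p x∈q = d (there x∈p) (there x∈q)

∣p∪q∣≡∣p∣+∣q∣ : ∀ {n} (p q : Subset n) → Disjoint p q → ∣ p ∪ q ∣ ≡ ∣ p ∣ + ∣ q ∣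
∣p∪q∣≡∣p∣+∣q∣ []            []            _ = refl
∣p∪q∣≡∣p∣+∣q∣ (inside  ∷ p) (inside  ∷ q) d = ⊥-elim (d here here)
∣p∪q∣≡∣p∣+∣q∣ (inside  ∷ p) (outside ∷ q) d = cong suc (∣p∪q∣≡∣p∣+∣q∣ p q (Disjoint-∷⁻ d))
∣p∪q∣≡∣p∣+∣q∣ (outside ∷ p) (inside  ∷ q) d =
  trans (cong suc (∣p∪q∣≡∣p∣+∣q∣ p q (Disjoint-∷⁻ d))) (sym (+-suc ∣ p ∣ ∣ q ∣))
∣p∪q∣≡∣p∣+∣q∣ (outside ∷ p) (outside ∷ q) d = ∣p∪q∣≡∣p∣+∣q∣ p q (Disjoint-∷⁻ d)

Disjoint-⋃ : ∀ {n} {p : Subset n} {qs} → All (Disjoint p) qs → Disjoint p (⋃ qs)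
Disjoint-⋃ []                       _   x∈⊥    = ∉⊥ x∈⊥
Disjoint-⋃ {qs = q ∷ qs} (d ∷ ds) x∈p x∈q∪⋃ with x∈p∪q⁻ q (⋃ qs) x∈q∪⋃
... | inj₁ x∈q = d x∈p x∈q
... | inj₂ x∈⋃ = Disjoint-⋃ ds x∈p x∈⋃

sum∣ps∣≡∣⋃ps∣ : ∀ {n} {ps : List (Subset n)} → AllPairs Disjoint ps → sum (map ∣_∣ ps) ≡ ∣ ⋃ ps ∣
sum∣ps∣≡∣⋃ps∣ {n} []                  = sym (∣⊥∣≡0 n)
sum∣ps∣≡∣⋃ps∣ {ps = p ∷ ps} (d ∷ ds) = begin
  ∣ p ∣ + sum (map ∣_∣ ps)  ≡⟨ cong (∣ p ∣ +_) (sum∣ps∣≡∣⋃ps∣ ds) ⟩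
  ∣ p ∣ + ∣ ⋃ ps ∣          ≡⟨ sym (∣p∪q∣≡∣p∣+∣q∣ p (⋃ ps) (Disjoint-⋃ d)) ⟩
  ∣ p ∪ ⋃ ps ∣              ∎
  where open ≡-Reasoning

sum∣ps∣≤n : ∀ {n} {ps : List (Subset n)} → AllPairs Disjoint ps → sum (map ∣_∣ ps) ≤ n
sum∣ps∣≤n {ps = ps} d = subst (_≤ _) (sym (sum∣ps∣≡∣⋃ps∣ d)) (∣p∣≤n (⋃ ps))

weight : ∀ {n} → ℕ → Subset n → ℕ
weight q p = q ^ ∣ ∁ p ∣

totalWeight : ∀ {n} → ℕ → List (Subset n) → ℕ
totalWeight q ps = sum (map (weight q) ps)

tailsWith : ∀ {n} → Bool → List (Subset (suc n)) → List (Subset n)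
tailsWith b []             = []
tailsWith b ((c ∷ p) ∷ ps) with c Bool.≟ b
... | yes _ = p ∷ tailsWith b ps
... | no _  = tailsWith b ps

totalWeight-split : ∀ {n} q (ps : List (Subset (suc n))) →
  totalWeight q ps ≡ totalWeight q (tailsWith inside ps) + q * totalWeight q (tailsWith outside ps)
totalWeight-split q []                   = sym (*-zeroʳ q)
totalWeight-split q ((inside  ∷ p) ∷ ps) =
  trans (cong (weight q p +_) (totalWeight-split q ps)) (sym (+-assoc (weight q p) _ _))
totalWeight-split q ((outside ∷ p) ∷ ps) = begin
  q * weight q p + totalWeight q ps   ≡⟨ cong (q * weight q p +_) (totalWeight-split q ps) ⟩
  q * weight q p + (I + q * O)        ≡⟨ x∙yz≈y∙xz (q * weight q p) I (q * O) ⟩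
  I + (q * weight q p + q * O)        ≡⟨ cong (I +_) (sym (*-distribˡ-+ q (weight q p) O)) ⟩
  I + q * (weight q p + O)            ∎
  where
  open ≡-Reasoning
  I = totalWeight q (tailsWith inside ps)
  O = totalWeight q (tailsWith outside ps)

tailsWith-∉ : ∀ {n b} {p : Subset n} (ps : List (Subset (suc n))) →
              All (b ∷ p ≢_) ps → All (p ≢_) (tailsWith b ps)
tailsWith-∉             []              []          = []
tailsWith-∉ {b = b} ((c ∷ p′) ∷ ps) (≢p′ ∷ ≢ps) with c Bool.≟ b
... | yes refl = (≢p′ ∘ cong (c ∷_)) ∷ tailsWith-∉ ps ≢ps
... | no _     = tailsWith-∉ ps ≢ps

tailsWith-unique : ∀ {n} b (ps : List (Subset (suc n))) → Unique ps → Unique (tailsWith b ps)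
tailsWith-unique b []             []          = []
tailsWith-unique b ((c ∷ p) ∷ ps) (∉ps ∷ !ps) with c Bool.≟ b
... | yes refl = tailsWith-∉ ps ∉ps ∷ tailsWith-unique b ps !ps
... | no _     = tailsWith-unique b ps !ps

totalWeight≤ : ∀ q n (ps : List (Subset n)) → Unique ps → totalWeight q ps ≤ suc q ^ n
totalWeight≤ q zero    []            _               = z≤n
totalWeight≤ q zero    ([] ∷ [])     _               = ≤-refl
totalWeight≤ q zero    ([] ∷ [] ∷ _) ((≢[] ∷ _) ∷ _) = contradiction refl ≢[]
totalWeight≤ q (suc n) ps            !ps             = begin
  totalWeight q ps  ≡⟨ totalWeight-split q ps ⟩
  I + q * O         ≤⟨ +-mono-≤ (bound inside) (*-monoʳ-≤ q (bound outside)) ⟩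
  suc q ^ suc n     ∎
  where
  open ≤-Reasoning
  I = totalWeight q (tailsWith inside ps)
  O = totalWeight q (tailsWith outside ps)
  bound : ∀ b → totalWeight q (tailsWith b ps) ≤ suc q ^ n
  bound b = totalWeight≤ q n (tailsWith b ps) (tailsWith-unique b ps !ps)

module _ {A : Set} where

  sum-map-*ˡ : ∀ k (g : A → ℕ) xs → sum (map (λ x → k * g x) xs) ≡ k * sum (map g xs)
  sum-map-*ˡ k g []       = sym (*-zeroʳ k)
  sum-map-*ˡ k g (x ∷ xs) =
    trans (cong (k * g x +_) (sum-map-*ˡ k g xs)) (sym (*-distribˡ-+ k (g x) _))

  sum-map-≥ : ∀ {c} (g : A → ℕ) xs → All (λ x → c ≤ g x) xs → length xs * c ≤ sum (map g xs)
  sum-map-≥ g []       []           = z≤n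
  sum-map-≥ g (x ∷ xs) (c≤gx ∷ c≤g) = +-mono-≤ c≤gx (sum-map-≥ g xs c≤g)

  some-≤-average : ∀ {k s} (g : A → ℕ) xs → length xs ≡ k → .{{_ : NonZero k}} →
                   sum (map g xs) ≤ s → Any (λ x → k * g x ≤ s) xs
  some-≤-average {k} {s} g xs refl Σ≤s with any? (λ x → k * g x ≤? s) xs
  ... | yes some = some
  ... | no none  = contradiction (*-cancelˡ-≤ k k*[1+s]≤k*s) (n≮n s)
    where
    open ≤-Reasoning
    k*[1+s]≤k*s : k * suc s ≤ k * s
    k*[1+s]≤k*s = begin
      k * suc s                     ≤⟨ sum-map-≥ (λ x → k * g x) xs (All.map ≰⇒> (¬Any⇒All¬ xs none)) ⟩
      sum (map (λ x → k * g x) xs)  ≡⟨ sum-map-*ˡ k g xs ⟩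
      k * sum (map g xs)            ≤⟨ *-monoʳ-≤ k Σ≤s ⟩
      k * s                         ∎

  Unique⇒some-≢ : DecidableEquality A → ∀ {xs : List A} → Unique xs → 2 ≤ length xs →
                  ∀ a → Any (_≢ a) xs
  Unique⇒some-≢ _≟_ {x ∷ y ∷ _} ((x≢y ∷ _) ∷ _) (s≤s (s≤s _)) a with x ≟ a
  ... | yes refl = there (here (x≢y ∘ sym))
  ... | no x≢a   = here x≢a

  AllPairs-map-All : ∀ {P : A → Set} {R S : A → A → Set} →
                     (∀ {x y} → P x → P y → R x y → S x y) →
                     ∀ {xs} → All P xs → AllPairs R xs → AllPairs S xs
  AllPairs-map-All h []         []         = []
  AllPairs-map-All h (px ∷ pxs) (rx ∷ rxs) =
    All.zipWith (λ (py , r) → h px py r) (pxs , rx) ∷ AllPairs-map-All h pxs rxs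

∣tabulate⌊P?⌋∣≡length∘filter : ∀ {A : Set} {P : A → Set} (P? : Decidable P) {n} (g : Fin n → A) →
                               ∣ tabulate (λ j → ⌊ P? (g j) ⌋) ∣ ≡ length (filter P? (List.tabulate g))
∣tabulate⌊P?⌋∣≡length∘filter P? {zero}  g = refl
∣tabulate⌊P?⌋∣≡length∘filter P? {suc n} g with P? (g zero)
... | yes _ = cong suc (∣tabulate⌊P?⌋∣≡length∘filter P? (g ∘ suc))
... | no _  = ∣tabulate⌊P?⌋∣≡length∘filter P? (g ∘ suc)

block : ∀ {t N} → (Fin t → Fin N) → Fin N → List (Fin t)
block f i = filter (λ j → f j ≟ i) (allFin _)

length-block : ∀ {t N} (f : Fin t → Fin N) i → length (block f i) ≡ blockSize f i
length-block f i = sym (∣tabulate⌊P?⌋∣≡length∘filter (λ j → f j ≟ i) (λ j → j))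

block-unique : ∀ {t N} (f : Fin t → Fin N) i → Unique (block f i)
block-unique f i = filter⁺ (λ j → f j ≟ i) (allFin⁺ _)

∈-block⁻ : ∀ {t N} (f : Fin t → Fin N) {i j} → j ∈ˡ block f i → f j ≡ i
∈-block⁻ {t} f {i} = proj₂ ∘ ∈-filter⁻ (λ j → f j ≟ i) {xs = allFin t}

transpose-matchˡ : ∀ {n} (i j : Fin n) → PC.transpose i j i ≡ j
transpose-matchˡ i j with i ≟ i
... | yes _  = refl
... | no i≢i = contradiction refl i≢i

transpose-other : ∀ {n} {i j k : Fin n} → k ≢ i → k ≢ j → PC.transpose i j k ≡ k
transpose-other {i = i} {j} {k} k≢i k≢j with k ≟ i
... | yes k≡i = contradiction k≡i k≢i
... | no _ with k ≟ j
...   | yes k≡j = contradiction k≡j k≢j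
...   | no _    = refl

transpose-preserves : ∀ {n} {B : Set} (h : Fin n → B) {i j} → h i ≡ h j →
                      ∀ k → h (PC.transpose i j k) ≡ h k
transpose-preserves h {i} {j} hi≡hj k with k ≟ i
... | yes refl = sym hi≡hj
... | no _ with k ≟ j
...   | yes refl = hi≡hj
...   | no _     = refl

IsUniqueResolution : ∀ {t m} (N : ℕ) → Family t m → (Fin t → Fin N) → Set
IsUniqueResolution N C f = IsResolution N C f × (∀ g → IsResolution N C g → SamePartition f g)

module _ {t m N} {C : Family t m} {f : Fin t → Fin N} where

  resolution-∘ : IsResolution N C f → (π : Permutation′ t) → (∀ j → C (π ⟨$⟩ʳ j) ≡ C j) →
                 IsResolution N C (f ∘ (π ⟨$⟩ʳ_))
  resolution-∘ (surjective , disjoint , covering) π Cπ≡C = surjective′ , disjoint′ , covering′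
    where
    Cπ⁻¹≡C : ∀ j → C (π ⟨$⟩ˡ j) ≡ C j
    Cπ⁻¹≡C j = trans (sym (Cπ≡C (π ⟨$⟩ˡ j))) (cong C (inverseʳ π))

    surjective′ : ∀ i → ∃ λ j → ∀ {z} → z ≡ j → f (π ⟨$⟩ʳ z) ≡ i
    surjective′ i = let j , fj≡i = surjective i in
      π ⟨$⟩ˡ j , λ z≡π⁻¹j → fj≡i (trans (cong (π ⟨$⟩ʳ_) z≡π⁻¹j) (inverseʳ π))

    disjoint′ : ∀ j j′ x → f (π ⟨$⟩ʳ j) ≡ f (π ⟨$⟩ʳ j′) → x ∈ C j → x ∈ C j′ → j ≡ j′
    disjoint′ j j′ x same x∈Cj x∈Cj′ = begin
      j                    ≡⟨ sym (inverseˡ π) ⟩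
      π ⟨$⟩ˡ (π ⟨$⟩ʳ j)    ≡⟨ cong (π ⟨$⟩ˡ_) πj≡πj′ ⟩
      π ⟨$⟩ˡ (π ⟨$⟩ʳ j′)   ≡⟨ inverseˡ π ⟩
      j′                   ∎
      where
      open ≡-Reasoning
      πj≡πj′ : π ⟨$⟩ʳ j ≡ π ⟨$⟩ʳ j′
      πj≡πj′ = disjoint _ _ x same (subst (x ∈_) (sym (Cπ≡C j)) x∈Cj)
                                   (subst (x ∈_) (sym (Cπ≡C j′)) x∈Cj′)

    covering′ : ∀ i x → ∃ λ j → f (π ⟨$⟩ʳ j) ≡ i × x ∈ C j
    covering′ i x = let j , fj≡i , x∈Cj = covering i x in
      π ⟨$⟩ˡ j , trans (cong f (inverseʳ π)) fj≡i , subst (x ∈_) (sym (Cπ⁻¹≡C j)) x∈Cj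

  -- Swapping a and b is again a resolution; it separates the block-mates a and j
  -- unless b was already in their block.
  equal-members-share-block : IsUniqueResolution N C f → ∀ {a b j} →
                              C a ≡ C b → j ≢ a → f j ≡ f a → f a ≡ f b
  equal-members-share-block (resolution , unique) {a} {b} {j} Ca≡Cb j≢a fj≡fa with j ≟ b
  ... | yes refl = sym fj≡fa
  ... | no j≢b   = begin
    f a      ≡⟨ sym fj≡fa ⟩
    f j      ≡⟨ cong f (sym (transpose-other j≢a j≢b)) ⟩
    f (τ j)  ≡⟨ sym (Equivalence.to (unique (f ∘ τ) swapped a j) (sym fj≡fa)) ⟩
    f (τ a)  ≡⟨ cong f (transpose-matchˡ a b) ⟩
    f b      ∎
    where
    open ≡-Reasoning
    τ = PC.transpose a b
    swapped = resolution-∘ resolution (Permutation.transpose a b) (transpose-preserves C Ca≡Cb)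

k*n≤m⇒n≤m/k : ∀ k {n m} .{{_ : NonZero k}} → k * n ≤ m → n ≤ m / k
k*n≤m⇒n≤m/k k {n} {m} k*n≤m =
  subst (_≤ m / k) (m*n/n≡m n k) (/-monoˡ-≤ k (subst (_≤ m) (*-comm k n) k*n≤m))

module _ {t m N q} .{{_ : NonZero q}} {C : Family t m} {f : Fin t → Fin N}
         (unique : IsUniqueResolution N C f) (block-size : ∀ i → blockSize f i ≡ suc q) where

  private
    length-block≡ : ∀ i → length (block f i) ≡ suc q
    length-block≡ i = trans (length-block f i) (block-size i)

  block-disjoint : ∀ i → AllPairs Disjoint (map C (block f i))
  block-disjoint i = AllPairs.map⁺ (AllPairs-map-All members-disjoint
    (all-filter (λ j → f j ≟ i) (allFin t)) (block-unique f i))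
    where
    disjoint = proj₁ (proj₂ (proj₁ unique))
    members-disjoint : ∀ {j j′} → f j ≡ i → f j′ ≡ i → j ≢ j′ → Disjoint (C j) (C j′)
    members-disjoint fj≡i fj′≡i j≢j′ x∈Cj x∈Cj′ =
      j≢j′ (disjoint _ _ _ (trans fj≡i (sym fj′≡i)) x∈Cj x∈Cj′)

  small-member : ∀ i → ∃ λ j → f j ≡ i × suc q * ∣ C j ∣ ≤ m
  small-member i =
    let j , j∈block , small = find (some-≤-average (∣_∣ ∘ C) (block f i) (length-block≡ i) total≤m)
    in j , ∈-block⁻ f j∈block , small
    where
    total≤m : sum (map (∣_∣ ∘ C) (block f i)) ≤ m
    total≤m = subst (_≤ m) (sym (cong sum (map-∘ (block f i)))) (sum∣ps∣≤n (block-disjoint i))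

  representative : Fin N → Fin t
  representative i = proj₁ (small-member i)

  representative-∈ : ∀ i → f (representative i) ≡ i
  representative-∈ i = proj₁ (proj₂ (small-member i))

  representative-injective : ∀ {i i′} → C (representative i) ≡ C (representative i′) → i ≡ i′
  representative-injective {i} {i′} same =
    let j , j∈block , j≢a = find (Unique⇒some-≢ _≟_ (block-unique f i) 2≤length (representative i))
        fj≡fa = trans (∈-block⁻ f j∈block) (sym (representative-∈ i))
    in begin
      i                      ≡⟨ sym (representative-∈ i) ⟩
      f (representative i)   ≡⟨ equal-members-share-block unique same j≢a fj≡fa ⟩
      f (representative i′)  ≡⟨ representative-∈ i′ ⟩
      i′                     ∎
    where
    open ≡-Reasoning
    2≤length : 2 ≤ length (block f i)
    2≤length = subst (2 ≤_) (sym (length-block≡ i)) (s≤s (>-nonZero⁻¹ q))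

  representative-weight : ∀ i → q ^ (m ∸ m / suc q) ≤ weight q (C (representative i))
  representative-weight i = begin
    q ^ (m ∸ m / suc q)  ≤⟨ ^-monoʳ-≤ q (∸-monoʳ-≤ m (k*n≤m⇒n≤m/k (suc q) small)) ⟩
    q ^ (m ∸ ∣ p ∣)      ≡⟨ cong (q ^_) (sym (∣∁p∣≡n∸∣p∣ p)) ⟩
    weight q p           ∎
    where
    open ≤-Reasoning
    p = C (representative i)
    small = proj₂ (proj₂ (small-member i))

  N*q^[m∸m/k]≤k^m : N * q ^ (m ∸ m / suc q) ≤ suc q ^ m
  N*q^[m∸m/k]≤k^m = begin
    N * c                        ≡⟨ cong (_* c) (sym (length-tabulate reps)) ⟩
    length (List.tabulate reps) * c
                                 ≤⟨ sum-map-≥ (weight q) _ (All.tabulate⁺ representative-weight) ⟩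
    totalWeight q (List.tabulate reps)
                                 ≤⟨ totalWeight≤ q m _ (tabulate⁺ representative-injective) ⟩
    suc q ^ m                    ∎
    where
    open ≤-Reasoning
    c = q ^ (m ∸ m / suc q)
    reps = C ∘ representative

^-distribʳ-* : ∀ a b n → (a * b) ^ n ≡ a ^ n * b ^ n
^-distribʳ-* a b zero    = refl
^-distribʳ-* a b (suc n) =
  trans (cong (a * b *_) (^-distribʳ-* a b n)) (*-interchange a b (a ^ n) (b ^ n))

m*q≤[m∸m/k]*k : ∀ m q → m * q ≤ (m ∸ m / suc q) * suc q
m*q≤[m∸m/k]*k m q = begin
  m * q                          ≡⟨ sym (m+n∸m≡n m (m * q)) ⟩
  m + m * q ∸ m                  ≡⟨ cong (_∸ m) (sym (*-suc m q)) ⟩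
  m * suc q ∸ m                  ≤⟨ ∸-monoʳ-≤ (m * suc q) (m/n*n≤m m (suc q)) ⟩
  m * suc q ∸ m / suc q * suc q  ≡⟨ sym (*-distribʳ-∸ (suc q) m (m / suc q)) ⟩
  (m ∸ m / suc q) * suc q        ∎
  where open ≤-Reasoning

N*q^[m∸m/k]≤k^m⇒N^k*q^[mq]≤k^[mk] : ∀ N m q .{{_ : NonZero q}} →
  N * q ^ (m ∸ m / suc q) ≤ suc q ^ m → N ^ suc q * q ^ (m * q) ≤ suc q ^ (m * suc q)
N*q^[m∸m/k]≤k^m⇒N^k*q^[mq]≤k^[mk] N m q N*c≤k^m = begin
  N ^ k * q ^ (m * q)            ≤⟨ *-monoʳ-≤ (N ^ k) (^-monoʳ-≤ q (m*q≤[m∸m/k]*k m q)) ⟩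
  N ^ k * q ^ ((m ∸ m / k) * k)  ≡⟨ cong (N ^ k *_) (sym (^-*-assoc q (m ∸ m / k) k)) ⟩
  N ^ k * (q ^ (m ∸ m / k)) ^ k  ≡⟨ sym (^-distribʳ-* N (q ^ (m ∸ m / k)) k) ⟩
  (N * q ^ (m ∸ m / k)) ^ k      ≤⟨ ^-monoˡ-≤ k N*c≤k^m ⟩
  (k ^ m) ^ k                    ≡⟨ ^-*-assoc k m k ⟩
  k ^ (m * k)                    ∎
  where
  open ≤-Reasoning
  k = suc q

achievable-bound : ∀ {m N} q .{{_ : NonZero q}} → Achievable (suc q) N m →
                   N ^ suc q * q ^ (m * q) ≤ suc q ^ (m * suc q)
achievable-bound {m} {N} q (_ , _ , _ , _ , resolution , unique , block-size) =
  N*q^[m∸m/k]≤k^m⇒N^k*q^[mq]≤k^[mk] N m q (N*q^[m∸m/k]≤k^m (resolution , unique) block-size)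

lemma25 : (m k : ℕ) → 1 ≤ m → 3 ≤ k → 2 * k ≤ m →
          (N : ℕ) → 1 ≤ N → Achievable k N m →
          N ^ k * (k ∸ 1) ^ (m * (k ∸ 1)) ≤ k ^ (m * k)
lemma25 m (suc (suc k′)) _ (s≤s (s≤s _)) _ N _ = achievable-bound (suc k′)
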